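{- Fix $k\ge 2$. There is a constant $c=c(k)>0$ such that the following holds. Let $H$ be an $n$-vertex, $m$-edge $k$-uniform multihypergraph and let $U\subseteq V(H)$ with $|U|=n-b$. Then either $e(H[U])\ge cm$, or $b>0$ and $H$ has a $2$-cut with excess at least $cm/b$.
   Context: A $k$-uniform multihypergraph has a vertex set and a multiset of $k$-element vertex subsets (edges). $H[U]$ is the induced subhypergraph on $U$ (all edges entirely contained in $U$) and $e(\cdot)$ counts edges with multiplicity. A $2$-cut is a partition of $V(H)$ into two labelled parts; its size is the number of edges having a vertex in each part; its excess is its size minus $(1-2^{1-k})m$, the expected size of a uniformly random $2$-cut. -}

module Defs where

open import Data.Nat using (ℕ; zero; suc; _∸_)
open import Data.Bool using (Bool; true; false; not; _∧_)
open import Data.List using (List; length; filter; []; _∷_)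
open import Data.List.Relation.Unary.All using (All)
open import Data.Fin.Subset using (Subset; ∣_∣; _∩_; ∁; _⊆_)
open import Data.Fin.Subset.Properties using (_⊆?_)
open import Data.Integer using (+_)
open import Data.Rational using (ℚ; _-_; _*_; 1ℚ; ½)
open import Relation.Binary.PropositionalEquality using (_≡_)
import Data.Nat as ℕ

record Hypergraph (k n : ℕ) : Set where
  field
    edges   : List (Subset n)
    uniform : All (λ e → ∣ e ∣ ≡ k) edges
open Hypergraph public

numEdges : ∀ {k n} → Hypergraph k n → ℕ
numEdges H = length (edges H)

inducedEdges : ∀ {k n} → Hypergraph k n → Subset n → ℕ
inducedEdges H U = length (filter (λ e → e ⊆? U) (edges H))

crosses : ∀ {n} → Subset n → Subset n → Bool
crosses S e = not (∣ e ∩ S ∣ ℕ.≡ᵇ 0) ∧ not (∣ e ∩ ∁ S ∣ ℕ.≡ᵇ 0)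

cutSize : ∀ {k n} → Hypergraph k n → Subset n → ℕ
cutSize H S = length (filter (λ e → crosses S e Data.Bool.≟ true) (edges H))

halfPow : ℕ → ℚ
halfPow zero    = 1ℚ
halfPow (suc j) = ½ * halfPow j

excess : ∀ {k n} → Hypergraph k n → Subset n → ℚ
excess {k} H S =
  (+ cutSize H S / 1) - (1ℚ - halfPow (k ∸ 1)) * (+ numEdges H / 1)
  where open Data.Rational using (_/_)

-- Write B = V ∖ U, K = 2^(k-1), and let p count the edges meeting B at least twice; a cut
-- with u uncut edges has excess m/K − u.  If e(H[U]) < m/(8K²) then b > 0, and every edge
-- not cut by (B, U) lies in U or is counted by p, so if p ≤ m/(4K) the cut (B, U) itself
-- has excess at least m/(8K²).  Otherwise, for each c < 2b, give the vertices of B of ranks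
-- r and c − r one common random bit with opposite signs and every other vertex its own
-- bit.  Each edge is then uncut with probability at most 2^(1−k) = 1/K, and an edge
-- containing vertices of B of ranks r ≠ r′ is never uncut when c = r + r′.  Averaging
-- over c and the bits gives a cut with u ≤ m/K − p/(2bK), i.e. excess > m/(8K²b).

module Submission where

module Combinatorics where

  open import Data.Bool using (Bool; true; false; not; _∧_; _xor_; T)
  import Data.Bool.Properties as Bool
  open import Data.Bool.Properties using (¬-not; not-distribˡ-xor; not-distribʳ-xor; ∧-zeroʳ; ∧-conicalˡ; ∧-conicalʳ)
  open import Data.Empty using (⊥-elim)
  open import Data.Fin using (Fin; zero; suc; toℕ; fromℕ<; _↑ˡ_; _↑ʳ_; splitAt)
  import Data.Fin.Properties as Fin
  open import Data.Fin.Subset using (Subset; ∣_∣; _∩_; ∁; _⊆_)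
  open import Data.Fin.Subset.Properties using (_⊆?_; ∣p∩q∣≤∣q∣; ∣∁p∣≡n∸∣p∣)
  open import Data.List using (List; []; _∷_; map; length; filter)
  open import Data.List.Properties using (filter-all)
  open import Data.List.Relation.Unary.All using (All; []; _∷_; universal)
  open import Data.Nat
    using (ℕ; zero; suc; _+_; _*_; _^_; _∸_; _⊓_; _≤_; _<_; z≤n; s≤s; _≟_; _≤?_; NonZero; >-nonZero; _≡ᵇ_; _≤ᵇ_; _<ᵇ_)
  open import Data.Nat.ListAction using (sum)
  open import Data.Nat.Properties
  open import Algebra.Properties.CommutativeSemigroup +-commutativeSemigroup using (interchange; x∙yz≈y∙xz)
  open import Data.Nat.Tactic.RingSolver using (solve-∀)
  open import Data.Product using (∃; _×_; _,_; proj₁; proj₂)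
  open import Data.Sum using (_⊎_; inj₁; inj₂)
  open import Data.Vec using (Vec; []; _∷_; lookup; tabulate; here; there)
  open import Data.Vec.Properties using (lookup-zipWith; lookup-map; lookup∘tabulate)
  open import Function using (_∘_)
  open import Relation.Binary.Definitions using (tri<; tri≈; tri>)
  open import Relation.Binary.PropositionalEquality
  open import Relation.Nullary using (¬_; Dec; yes; no; does; _×-dec_; ¬?)
  open import Defs

  𝟙 : Bool → ℕ
  𝟙 true  = 1
  𝟙 false = 0

  𝟙≤1 : ∀ x → 𝟙 x ≤ 1
  𝟙≤1 true  = s≤s z≤n
  𝟙≤1 false = z≤n

  sumCube : ∀ N → (Vec Bool N → ℕ) → ℕ
  sumCube zero    h = h []
  sumCube (suc N) h = sumCube N (h ∘ (true ∷_)) + sumCube N (h ∘ (false ∷_))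

  sumCube-cong : ∀ N {h g : Vec Bool N → ℕ} → (∀ y → h y ≡ g y) → sumCube N h ≡ sumCube N g
  sumCube-cong zero    eq = eq []
  sumCube-cong (suc N) eq = cong₂ _+_ (sumCube-cong N (eq ∘ (true ∷_))) (sumCube-cong N (eq ∘ (false ∷_)))

  sumCube-mono-≤ : ∀ N {h g : Vec Bool N → ℕ} → (∀ y → h y ≤ g y) → sumCube N h ≤ sumCube N g
  sumCube-mono-≤ zero    le = le []
  sumCube-mono-≤ (suc N) le = +-mono-≤ (sumCube-mono-≤ N (le ∘ (true ∷_))) (sumCube-mono-≤ N (le ∘ (false ∷_)))

  sumCube-+ : ∀ N (h g : Vec Bool N → ℕ) → sumCube N (λ y → h y + g y) ≡ sumCube N h + sumCube N g
  sumCube-+ zero    h g = refl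
  sumCube-+ (suc N) h g = trans (cong₂ _+_ (sumCube-+ N h₁ g₁) (sumCube-+ N h₀ g₀))
    (interchange (sumCube N h₁) (sumCube N g₁) (sumCube N h₀) (sumCube N g₀))
    where
    h₁ = h ∘ (true ∷_)
    g₁ = g ∘ (true ∷_)
    h₀ = h ∘ (false ∷_)
    g₀ = g ∘ (false ∷_)

  sumCube-zero : ∀ N → sumCube N (λ _ → 0) ≡ 0
  sumCube-zero zero    = refl
  sumCube-zero (suc N) = cong₂ _+_ (sumCube-zero N) (sumCube-zero N)

  sumCube-one : ∀ N → sumCube N (λ _ → 1) ≡ 2 ^ N
  sumCube-one zero    = refl
  sumCube-one (suc N) = trans (cong₂ _+_ (sumCube-one N) (sumCube-one N)) (cong (2 ^ N +_) (sym (+-identityʳ _)))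

  flipAt : ∀ {N} → Fin N → Vec Bool N → Vec Bool N
  flipAt zero    (x ∷ y) = not x ∷ y
  flipAt (suc j) (x ∷ y) = x ∷ flipAt j y

  lookup-flipAt-same : ∀ {N} (j : Fin N) y → lookup (flipAt j y) j ≡ not (lookup y j)
  lookup-flipAt-same zero    (x ∷ y) = refl
  lookup-flipAt-same (suc j) (x ∷ y) = lookup-flipAt-same j y

  lookup-flipAt-other : ∀ {N} (j t : Fin N) y → t ≢ j → lookup (flipAt j y) t ≡ lookup y t
  lookup-flipAt-other zero    zero    (x ∷ y) t≢j = ⊥-elim (t≢j refl)
  lookup-flipAt-other zero    (suc t) (x ∷ y) t≢j = refl
  lookup-flipAt-other (suc j) zero    (x ∷ y) t≢j = refl
  lookup-flipAt-other (suc j) (suc t) (x ∷ y) t≢j = lookup-flipAt-other j t y (t≢j ∘ cong suc)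

  sumCube-flipAt : ∀ N (j : Fin N) (h : Vec Bool N → ℕ) → sumCube N (h ∘ flipAt j) ≡ sumCube N h
  sumCube-flipAt (suc N) zero    h = +-comm (sumCube N (h ∘ (false ∷_))) (sumCube N (h ∘ (true ∷_)))
  sumCube-flipAt (suc N) (suc j) h =
    cong₂ _+_ (sumCube-flipAt N j (h ∘ (true ∷_))) (sumCube-flipAt N j (h ∘ (false ∷_)))

  double-≤-+ : ∀ a {x s t} → a * x ≤ s → a * x ≤ t → 2 * a * x ≤ s + t
  double-≤-+ a {x} p q =
    ≤-trans (≤-reflexive (trans (*-assoc 2 a x) (cong (a * x +_) (+-identityʳ _)))) (+-mono-≤ p q)

  sumCube-average : ∀ N (h : Vec Bool N → ℕ) → ∃ λ y → 2 ^ N * h y ≤ sumCube N h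
  sumCube-average zero    h = [] , ≤-reflexive (+-identityʳ (h []))
  sumCube-average (suc N) h
    with sumCube-average N (h ∘ (true ∷_)) | sumCube-average N (h ∘ (false ∷_))
  ... | y₁ , le₁ | y₂ , le₂ with ≤-total (h (true ∷ y₁)) (h (false ∷ y₂))
  ... | inj₁ le = true ∷ y₁ , double-≤-+ (2 ^ N) le₁ (≤-trans (*-monoʳ-≤ (2 ^ N) le) le₂)
  ... | inj₂ le = false ∷ y₂ , double-≤-+ (2 ^ N) (≤-trans (*-monoʳ-≤ (2 ^ N) le) le₁) le₂

  sumBelow : ℕ → (ℕ → ℕ) → ℕ
  sumBelow zero    h = 0
  sumBelow (suc L) h = h L + sumBelow L h

  sumBelow-cong : ∀ L {h g : ℕ → ℕ} → (∀ c → h c ≡ g c) → sumBelow L h ≡ sumBelow L g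
  sumBelow-cong zero    eq = refl
  sumBelow-cong (suc L) eq = cong₂ _+_ (eq L) (sumBelow-cong L eq)

  sumBelow-+ : ∀ L (h g : ℕ → ℕ) → sumBelow L (λ c → h c + g c) ≡ sumBelow L h + sumBelow L g
  sumBelow-+ zero    h g = refl
  sumBelow-+ (suc L) h g =
    trans (cong (h L + g L +_) (sumBelow-+ L h g)) (interchange (h L) (g L) (sumBelow L h) (sumBelow L g))

  sumBelow-zero : ∀ L → sumBelow L (λ _ → 0) ≡ 0
  sumBelow-zero zero    = refl
  sumBelow-zero (suc L) = sumBelow-zero L

  sumBelow-*ˡ : ∀ L K (h : ℕ → ℕ) → K * sumBelow L h ≡ sumBelow L (λ c → K * h c)
  sumBelow-*ˡ zero    K h = *-zeroʳ K
  sumBelow-*ˡ (suc L) K h = trans (*-distribˡ-+ K (h L) _) (cong (K * h L +_) (sumBelow-*ˡ L K h))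

  sumBelow-≤ : ∀ L {h : ℕ → ℕ} {M} → (∀ c → c < L → h c ≤ M) → sumBelow L h ≤ L * M
  sumBelow-≤ zero    le = z≤n
  sumBelow-≤ (suc L) le = +-mono-≤ (le L ≤-refl) (sumBelow-≤ L (λ c c<L → le c (m≤n⇒m≤1+n c<L)))

  sumBelow-≤-vanishing : ∀ L {h : ℕ → ℕ} {M} c₀ → c₀ < L → (∀ c → c < L → h c ≤ M) → h c₀ ≡ 0 →
                         M + sumBelow L h ≤ L * M
  sumBelow-≤-vanishing (suc L) {h} {M} c₀ c₀<L le h₀ with c₀ ≟ L
  ... | yes refl rewrite h₀ = +-monoʳ-≤ M (sumBelow-≤ L (λ c c<L → le c (m≤n⇒m≤1+n c<L)))
  ... | no c₀≢L = begin
    M + (h L + sumBelow L h) ≡⟨ x∙yz≈y∙xz M (h L) _ ⟩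
    h L + (M + sumBelow L h) ≤⟨ +-mono-≤ (le L ≤-refl) (sumBelow-≤-vanishing L c₀ c₀<L′ le′ h₀) ⟩
    M + L * M                ∎
    where
    open ≤-Reasoning
    c₀<L′ = ≤∧≢⇒< (≤-pred c₀<L) c₀≢L
    le′ = λ c c<L → le c (m≤n⇒m≤1+n c<L)

  sumBelow-average : ∀ L (h : ℕ → ℕ) → 0 < L → ∃ λ c → c < L × L * h c ≤ sumBelow L h
  sumBelow-average (suc zero)    h _ = 0 , s≤s z≤n , ≤-reflexive (cong (h 0 +_) (+-comm 0 0))
  sumBelow-average (suc (suc L)) h _ with sumBelow-average (suc L) h (s≤s z≤n)
  ... | c , c<L , le with ≤-total (h (suc L)) (h c)
  ... | inj₁ hL≤hc = suc L , ≤-refl , +-monoʳ-≤ (h (suc L)) (≤-trans (*-monoʳ-≤ (suc L) hL≤hc) le)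
  ... | inj₂ hc≤hL = c , m≤n⇒m≤1+n c<L , +-mono-≤ hc≤hL le

  sum-map-mono-≤ : ∀ {A : Set} {P : A → Set} {f g : A → ℕ} (xs : List A) → All P xs →
                   (∀ x → P x → f x ≤ g x) → sum (map f xs) ≤ sum (map g xs)
  sum-map-mono-≤ []       []         le = z≤n
  sum-map-mono-≤ (x ∷ xs) (px ∷ pxs) le = +-mono-≤ (le x px) (sum-map-mono-≤ xs pxs le)

  sum-map-+ : ∀ {A : Set} (f g : A → ℕ) xs → sum (map (λ x → f x + g x) xs) ≡ sum (map f xs) + sum (map g xs)
  sum-map-+ f g []       = refl
  sum-map-+ f g (x ∷ xs) =
    trans (cong (f x + g x +_) (sum-map-+ f g xs)) (interchange (f x) (g x) (sum (map f xs)) (sum (map g xs)))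

  sum-map-*ˡ : ∀ {A : Set} K (f : A → ℕ) xs → K * sum (map f xs) ≡ sum (map (λ x → K * f x) xs)
  sum-map-*ˡ K f []       = *-zeroʳ K
  sum-map-*ˡ K f (x ∷ xs) = trans (*-distribˡ-+ K (f x) _) (cong (K * f x +_) (sum-map-*ˡ K f xs))

  sum-map-*ʳ : ∀ {A : Set} K (f : A → ℕ) xs → sum (map f xs) * K ≡ sum (map (λ x → f x * K) xs)
  sum-map-*ʳ K f []       = refl
  sum-map-*ʳ K f (x ∷ xs) = trans (*-distribʳ-+ K (f x) _) (cong (f x * K +_) (sum-map-*ʳ K f xs))

  sum-map-const : ∀ {A : Set} K (xs : List A) → sum (map (λ _ → K) xs) ≡ length xs * K
  sum-map-const K []       = refl
  sum-map-const K (x ∷ xs) = cong (K +_) (sum-map-const K xs)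

  sum-map-swap : ∀ {I A : Set} (∑ : (I → ℕ) → ℕ) → ∑ (λ _ → 0) ≡ 0 →
                 (∀ f g → ∑ (λ i → f i + g i) ≡ ∑ f + ∑ g) →
                 ∀ (F : I → A → ℕ) xs → ∑ (λ i → sum (map (F i) xs)) ≡ sum (map (λ x → ∑ (λ i → F i x)) xs)
  sum-map-swap ∑ ∑-zero ∑-+ F []       = ∑-zero
  sum-map-swap ∑ ∑-zero ∑-+ F (x ∷ xs) =
    trans (∑-+ (λ i → F i x) (λ i → sum (map (F i) xs))) (cong (∑ (λ i → F i x) +_) (sum-map-swap ∑ ∑-zero ∑-+ F xs))

  allOn : ∀ {n} → Subset n → (Fin n → Bool) → Bool
  allOn []          F = true
  allOn (true  ∷ e) F = F zero ∧ allOn e (F ∘ suc)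
  allOn (false ∷ e) F = allOn e (F ∘ suc)

  allOn-cong : ∀ {n} (e : Subset n) {F G : Fin n → Bool} →
               (∀ i → lookup e i ≡ true → F i ≡ G i) → allOn e F ≡ allOn e G
  allOn-cong []          eq = refl
  allOn-cong (true  ∷ e) eq = cong₂ _∧_ (eq zero refl) (allOn-cong e (eq ∘ suc))
  allOn-cong (false ∷ e) eq = allOn-cong e (eq ∘ suc)

  allOn-elim : ∀ {n} (e : Subset n) {F : Fin n → Bool} → allOn e F ≡ true →
               ∀ i → lookup e i ≡ true → F i ≡ true
  allOn-elim (true  ∷ e) {F} all zero    _   = ∧-conicalˡ (F zero) _ all
  allOn-elim (true  ∷ e) {F} all (suc i) i∈e = allOn-elim e (∧-conicalʳ (F zero) _ all) i i∈e
  allOn-elim (false ∷ e)     all (suc i) i∈e = allOn-elim e all i i∈e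

  disjoint⇒allOn-not : ∀ {n} (e : Subset n) (F : Fin n → Bool) → ∣ e ∩ tabulate F ∣ ≡ 0 → allOn e (not ∘ F) ≡ true
  disjoint⇒allOn-not []          F _ = refl
  disjoint⇒allOn-not (false ∷ e) F h = disjoint⇒allOn-not e (F ∘ suc) h
  disjoint⇒allOn-not (true  ∷ e) F h with F zero
  ... | false = disjoint⇒allOn-not e (F ∘ suc) h

  disjoint-∁⇒allOn : ∀ {n} (e : Subset n) (F : Fin n → Bool) → ∣ e ∩ ∁ (tabulate F) ∣ ≡ 0 → allOn e F ≡ true
  disjoint-∁⇒allOn []          F _ = refl
  disjoint-∁⇒allOn (false ∷ e) F h = disjoint-∁⇒allOn e (F ∘ suc) h
  disjoint-∁⇒allOn (true  ∷ e) F h with F zero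
  ... | true = disjoint-∁⇒allOn e (F ∘ suc) h

  ≡ᵇ0⇒≡0 : ∀ x → (x ≡ᵇ 0) ≡ true → x ≡ 0
  ≡ᵇ0⇒≡0 zero _ = refl

  uncut : ∀ {n} → Subset n → Subset n → ℕ
  uncut S e = 𝟙 (not (crosses S e))

  uncut-≤-allOn : ∀ {n} (e : Subset n) (F : Fin n → Bool) →
                  uncut (tabulate F) e ≤ 𝟙 (allOn e F) + 𝟙 (allOn e (not ∘ F))
  uncut-≤-allOn e F with ∣ e ∩ tabulate F ∣ ≡ᵇ 0 in e∩S | ∣ e ∩ ∁ (tabulate F) ∣ ≡ᵇ 0 in e∩∁S
  ... | false | false = z≤n
  ... | true  | _ rewrite disjoint⇒allOn-not e F (≡ᵇ0⇒≡0 _ e∩S) = m≤n+m 1 (𝟙 (allOn e F))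
  ... | false | true rewrite disjoint-∁⇒allOn e F (≡ᵇ0⇒≡0 _ e∩∁S) = s≤s z≤n

  ∣p∣>0 : ∀ {n} (p : Subset n) i → lookup p i ≡ true → 0 < ∣ p ∣
  ∣p∣>0 (true  ∷ p) i       _   = s≤s z≤n
  ∣p∣>0 (false ∷ p) (suc i) i∈p = ∣p∣>0 p i i∈p

  crosses-intro : ∀ {n} (S e : Subset n) → 0 < ∣ e ∩ S ∣ → 0 < ∣ e ∩ ∁ S ∣ → crosses S e ≡ true
  crosses-intro S e p q with ∣ e ∩ S ∣ | ∣ e ∩ ∁ S ∣
  crosses-intro S e (s≤s _) (s≤s _) | suc _ | suc _ = refl

  crosses-≡true : ∀ {n} (S e : Subset n) i j → lookup e i ≡ true → lookup e j ≡ true →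
                  lookup S i ≡ true → lookup S j ≡ false → crosses S e ≡ true
  crosses-≡true S e i j i∈e j∈e i∈S j∉S = crosses-intro S e
    (∣p∣>0 (e ∩ S) i (trans (lookup-zipWith _∧_ i e S) (cong₂ _∧_ i∈e i∈S)))
    (∣p∣>0 (e ∩ ∁ S) j (trans (lookup-zipWith _∧_ j e (∁ S)) (cong₂ _∧_ j∈e (trans (lookup-map j not S) (cong not j∉S)))))

  ∈∩⁻ : ∀ {n} (p q : Subset n) i → lookup (p ∩ q) i ≡ true → lookup p i ≡ true × lookup q i ≡ true
  ∈∩⁻ p q i i∈p∩q = let eq = trans (sym (lookup-zipWith _∧_ i p q)) i∈p∩q in ∧-conicalˡ _ _ eq , ∧-conicalʳ _ _ eq

  two-members : ∀ {n} (p : Subset n) → 2 ≤ ∣ p ∣ →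
                ∃ λ i → ∃ λ j → i ≢ j × lookup p i ≡ true × lookup p j ≡ true
  two-members (true ∷ p) (s≤s 1≤∣p∣) = zero , suc (proj₁ member) , (λ ()) , refl , proj₂ member
    where
    some-member : ∀ {m} (q : Subset m) → 1 ≤ ∣ q ∣ → ∃ λ i → lookup q i ≡ true
    some-member (true  ∷ q) _ = zero , refl
    some-member (false ∷ q) h = let i , i∈q = some-member q h in suc i , i∈q
    member = some-member p 1≤∣p∣
  two-members (false ∷ p) h =
    let i , j , i≢j , i∈p , j∈p = two-members p h in suc i , suc j , i≢j ∘ Fin.suc-injective , i∈p , j∈p

  assign : ∀ {N n} → (Fin n → Fin N) → (Fin n → Bool) → Vec Bool N → Fin n → Bool
  assign bit sign y i = lookup y (bit i) xor sign i

  SignSeparated : ∀ {N n} → (Fin n → Fin N) → (Fin n → Bool) → Subset n → Set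
  SignSeparated bit sign e =
    ∀ i j → i ≢ j → lookup e i ≡ true → lookup e j ≡ true → bit i ≡ bit j → sign i ≢ sign j

  𝟙-∧-split : ∀ a r → 𝟙 (a ∧ r) + 𝟙 (not a ∧ r) ≡ 𝟙 r
  𝟙-∧-split true  true  = refl
  𝟙-∧-split true  false = refl
  𝟙-∧-split false true  = refl
  𝟙-∧-split false false = refl

  xor-opposite : ∀ y {g g′} → g′ ≢ g → y xor g′ ≡ true → y xor g ≡ false
  xor-opposite y {g} g′≢g yg′ rewrite ¬-not g′≢g | sym (not-distribʳ-xor y g) with y xor g
  ... | false = refl

  -- Each vertex of e halves the number of vectors making all of e true, unless it shares
  -- its bit with another vertex of e, which then forces the opposite value.
  sumCube-allOn-≤ : ∀ {N n} (e : Subset n) (bit : Fin n → Fin N) (sign : Fin n → Bool) → SignSeparated bit sign e →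
                    2 ^ ∣ e ∣ * sumCube N (λ y → 𝟙 (allOn e (assign bit sign y))) ≤ 2 ^ N
  sumCube-allOn-≤ {N} [] bit sign sep =
    ≤-reflexive (trans (+-identityʳ _) (sumCube-one N))
  sumCube-allOn-≤ (false ∷ e) bit sign sep =
    sumCube-allOn-≤ e (bit ∘ suc) (sign ∘ suc) (λ i j i≢j → sep (suc i) (suc j) (i≢j ∘ Fin.suc-injective))
  sumCube-allOn-≤ {N} (true ∷ e) bit sign sep
    with Fin.any? (λ j → (lookup e j Bool.≟ true) ×-dec (bit (suc j) Fin.≟ bit zero))
  ... | yes (j , j∈e , same-bit) = ≤-trans (≤-reflexive (trans (cong (2 ^ suc ∣ e ∣ *_) S≡0) (*-zeroʳ (2 ^ suc ∣ e ∣)))) z≤n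
    where
    term≡0 : ∀ y → 𝟙 (assign bit sign y zero ∧ allOn e (assign (bit ∘ suc) (sign ∘ suc) y)) ≡ 0
    term≡0 y with allOn e (assign (bit ∘ suc) (sign ∘ suc) y) in all
    ... | false = cong 𝟙 (∧-zeroʳ _)
    ... | true  = cong (λ x → 𝟙 (x ∧ true)) (xor-opposite (lookup y (bit zero))
                    (sep (suc j) zero (λ ()) j∈e refl same-bit)
                    (subst (λ b → lookup y b xor sign (suc j) ≡ true) same-bit (allOn-elim e all j j∈e)))
    S≡0 = trans (sumCube-cong N term≡0) (sumCube-zero N)
  ... | no fresh-bit = ≤-trans (≤-reflexive halve) (sumCube-allOn-≤ e (bit ∘ suc) (sign ∘ suc) sep′)
    where
    sep′ = λ i j i≢j → sep (suc i) (suc j) (i≢j ∘ Fin.suc-injective)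
    lit : Vec Bool N → Bool
    lit y = assign bit sign y zero
    rest : Vec Bool N → Bool
    rest y = allOn e (assign (bit ∘ suc) (sign ∘ suc) y)
    rest-flip : ∀ y → rest (flipAt (bit zero) y) ≡ rest y
    rest-flip y = allOn-cong e (λ i i∈e →
      cong (_xor sign (suc i)) (lookup-flipAt-other (bit zero) (bit (suc i)) y (λ eq → fresh-bit (i , i∈e , eq))))
    lit-flip : ∀ y → lit (flipAt (bit zero) y) ≡ not (lit y)
    lit-flip y = trans (cong (_xor sign zero) (lookup-flipAt-same (bit zero) y)) (sym (not-distribˡ-xor (lookup y (bit zero)) (sign zero)))
    S  = sumCube N (λ y → 𝟙 (lit y ∧ rest y))
    S′ = sumCube N (λ y → 𝟙 (not (lit y) ∧ rest y))
    S′≡S : S′ ≡ S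
    S′≡S = trans (sumCube-cong N (λ y → cong 𝟙 (sym (cong₂ _∧_ (lit-flip y) (rest-flip y)))))
                 (sumCube-flipAt N (bit zero) (λ y → 𝟙 (lit y ∧ rest y)))
    S+S′ : S + S′ ≡ sumCube N (𝟙 ∘ rest)
    S+S′ = trans (sym (sumCube-+ N _ _)) (sumCube-cong N (λ y → 𝟙-∧-split (lit y) (rest y)))
    halve : 2 ^ suc ∣ e ∣ * S ≡ 2 ^ ∣ e ∣ * sumCube N (𝟙 ∘ rest)
    halve = begin
      2 * 2 ^ ∣ e ∣ * S       ≡⟨ cong (_* S) (*-comm 2 (2 ^ ∣ e ∣)) ⟩
      2 ^ ∣ e ∣ * 2 * S       ≡⟨ *-assoc (2 ^ ∣ e ∣) 2 S ⟩
      2 ^ ∣ e ∣ * (S + (S + 0)) ≡⟨ cong (λ x → 2 ^ ∣ e ∣ * (S + x)) (trans (+-identityʳ S) (sym S′≡S)) ⟩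
      2 ^ ∣ e ∣ * (S + S′)    ≡⟨ cong (2 ^ ∣ e ∣ *_) S+S′ ⟩
      2 ^ ∣ e ∣ * sumCube N (𝟙 ∘ rest) ∎
      where open ≡-Reasoning

  rank : ∀ {n} → Subset n → Fin n → ℕ
  rank (x ∷ B) zero    = 0
  rank (x ∷ B) (suc i) = 𝟙 x + rank B i

  rank-≤ : ∀ {n} (B : Subset n) i → rank B i ≤ toℕ i
  rank-≤ (x ∷ B) zero    = z≤n
  rank-≤ (x ∷ B) (suc i) = +-mono-≤ (𝟙≤1 x) (rank-≤ B i)

  rank-< : ∀ {n} (B : Subset n) i → lookup B i ≡ true → rank B i < ∣ B ∣
  rank-< (true  ∷ B) zero    _   = s≤s z≤n
  rank-< (true  ∷ B) (suc i) i∈B = s≤s (rank-< B i i∈B)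
  rank-< (false ∷ B) (suc i) i∈B = rank-< B i i∈B

  rank-injective : ∀ {n} (B : Subset n) {i j} → lookup B i ≡ true → lookup B j ≡ true → rank B i ≡ rank B j → i ≡ j
  rank-injective (x     ∷ B) {zero}  {zero}  _   _   _  = refl
  rank-injective (true  ∷ B) {zero}  {suc j} _   _   ()
  rank-injective (true  ∷ B) {suc i} {zero}  _   _   ()
  rank-injective (true  ∷ B) {suc i} {suc j} i∈B j∈B eq = cong suc (rank-injective B i∈B j∈B (suc-injective eq))
  rank-injective (false ∷ B) {suc i} {suc j} i∈B j∈B eq = cong suc (rank-injective B i∈B j∈B eq)

  ⊓-∸-collision : ∀ {c m n} → m ≤ c → n ≤ c → m ≢ n → m ⊓ (c ∸ m) ≡ n ⊓ (c ∸ n) → n ≡ c ∸ m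
  ⊓-∸-collision {c} {m} {n} m≤c n≤c m≢n eq with ⊓-sel m (c ∸ m) | ⊓-sel n (c ∸ n)
  ... | inj₁ a | inj₁ b = ⊥-elim (m≢n (trans (sym a) (trans eq b)))
  ... | inj₁ a | inj₂ b = trans (sym (m∸[m∸n]≡n n≤c)) (cong (c ∸_) (trans (sym b) (trans (sym eq) a)))
  ... | inj₂ a | inj₁ b = trans (sym b) (trans (sym eq) a)
  ... | inj₂ a | inj₂ b =
    ⊥-elim (m≢n (trans (sym (m∸[m∸n]≡n m≤c)) (trans (cong (c ∸_) (trans (sym a) (trans eq b))) (m∸[m∸n]≡n n≤c))))

  <ᵇ-swap-≢ : ∀ {m n} → m ≢ n → (n <ᵇ m) ≢ (m <ᵇ n)
  <ᵇ-swap-≢ {m} {n} m≢n eq with <-cmp m n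
  ... | tri< m<n _ _ = <-asym m<n (<ᵇ⇒< n m (subst T (sym eq) (<⇒<ᵇ m<n)))
  ... | tri≈ _ m≡n _ = m≢n m≡n
  ... | tri> _ _ n<m = <-asym n<m (<ᵇ⇒< m n (subst T eq (<⇒<ᵇ n<m)))

  complementary-<ᵇ-≢ : ∀ {c m n} → m ≢ n → c ∸ m ≡ n → c ∸ n ≡ m → (c ∸ m <ᵇ m) ≢ (c ∸ n <ᵇ n)
  complementary-<ᵇ-≢ m≢n refl c∸n≡m rewrite c∸n≡m = <ᵇ-swap-≢ m≢n

  -- For each c, the vertices of B of ranks r and c ∸ r are wired to one shared bit with
  -- opposite signs, so that they always land on opposite sides of the cut; every other
  -- vertex gets a private bit.
  module Pairing {n} (B : Subset n) (c : ℕ) where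

    Paired : Fin n → Set
    Paired i = lookup B i ≡ true × rank B i ≤ c × c ∸ rank B i ≢ rank B i

    paired? : ∀ i → Dec (Paired i)
    paired? i = (lookup B i Bool.≟ true) ×-dec (rank B i ≤? c) ×-dec ¬? (c ∸ rank B i ≟ rank B i)

    key<n : ∀ i → rank B i ⊓ (c ∸ rank B i) < n
    key<n i = ≤-<-trans (m⊓n≤m _ _) (≤-<-trans (rank-≤ B i) (Fin.toℕ<n i))

    bit : Fin n → Fin (n + n)
    bit i with paired? i
    ... | yes _ = n ↑ʳ fromℕ< (key<n i)
    ... | no  _ = i ↑ˡ n

    sign : Fin n → Bool
    sign i with paired? i
    ... | yes _ = c ∸ rank B i <ᵇ rank B i
    ... | no  _ = false

    cut : Vec Bool (n + n) → Subset n
    cut y = tabulate (assign bit sign y)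

    ↑ˡ≢↑ʳ : ∀ (i j : Fin n) → i ↑ˡ n ≢ n ↑ʳ j
    ↑ˡ≢↑ʳ i j eq with trans (sym (Fin.splitAt-↑ˡ n i n)) (trans (cong (splitAt n) eq) (Fin.splitAt-↑ʳ n n j))
    ... | ()

    shared-bit⇒opposite-sign : ∀ i j → i ≢ j → bit i ≡ bit j → sign i ≢ sign j
    shared-bit⇒opposite-sign i j i≢j eq with paired? i | paired? j
    ... | no _  | no _  = ⊥-elim (i≢j (Fin.↑ˡ-injective n i j eq))
    ... | no _  | yes _ = ⊥-elim (↑ˡ≢↑ʳ i _ eq)
    ... | yes _ | no _  = ⊥-elim (↑ˡ≢↑ʳ j _ (sym eq))
    ... | yes (i∈B , rᵢ≤c , _) | yes (j∈B , rⱼ≤c , _) =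
      complementary-<ᵇ-≢ rᵢ≢rⱼ (sym (⊓-∸-collision rᵢ≤c rⱼ≤c rᵢ≢rⱼ same-key))
                               (sym (⊓-∸-collision rⱼ≤c rᵢ≤c (rᵢ≢rⱼ ∘ sym) (sym same-key)))
      where
      rᵢ≢rⱼ : rank B i ≢ rank B j
      rᵢ≢rⱼ = i≢j ∘ rank-injective B i∈B j∈B
      same-key : rank B i ⊓ (c ∸ rank B i) ≡ rank B j ⊓ (c ∸ rank B j)
      same-key = Fin.fromℕ<-injective _ _ (key<n i) (key<n j) (Fin.↑ʳ-injective n _ _ eq)

    module _ {i j} (i∈B : lookup B i ≡ true) (j∈B : lookup B j ≡ true) (i≢j : i ≢ j)
             (c≡rᵢ+rⱼ : c ≡ rank B i + rank B j) where

      private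
        rᵢ≢rⱼ : rank B i ≢ rank B j
        rᵢ≢rⱼ = i≢j ∘ rank-injective B i∈B j∈B
        c∸rᵢ : c ∸ rank B i ≡ rank B j
        c∸rᵢ = trans (cong (_∸ rank B i) c≡rᵢ+rⱼ) (m+n∸m≡n (rank B i) (rank B j))
        c∸rⱼ : c ∸ rank B j ≡ rank B i
        c∸rⱼ = trans (cong (_∸ rank B j) c≡rᵢ+rⱼ) (m+n∸n≡m (rank B i) (rank B j))
        paired-i : Paired i
        paired-i = i∈B , subst (rank B i ≤_) (sym c≡rᵢ+rⱼ) (m≤m+n _ _) , λ eq → rᵢ≢rⱼ (sym (trans (sym c∸rᵢ) eq))
        paired-j : Paired j
        paired-j = j∈B , subst (rank B j ≤_) (sym c≡rᵢ+rⱼ) (m≤n+m _ _) , λ eq → rᵢ≢rⱼ (trans (sym c∸rⱼ) eq)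

      partners-share-bit : bit i ≡ bit j
      partners-share-bit with paired? i | paired? j
      ... | yes _ | yes _ = cong (n ↑ʳ_) (Fin.fromℕ<-cong _ _ same-key (key<n i) (key<n j))
        where
        same-key = trans (cong (rank B i ⊓_) c∸rᵢ) (trans (⊓-comm _ _) (cong (rank B j ⊓_) (sym c∸rⱼ)))
      ... | no ¬p | _     = ⊥-elim (¬p paired-i)
      ... | _     | no ¬p = ⊥-elim (¬p paired-j)

      partners-opposite-sign : sign i ≢ sign j
      partners-opposite-sign with paired? i | paired? j
      ... | yes _ | yes _ = complementary-<ᵇ-≢ rᵢ≢rⱼ c∸rᵢ c∸rⱼ
      ... | no ¬p | _     = ⊥-elim (¬p paired-i)
      ... | _     | no ¬p = ⊥-elim (¬p paired-j)

      partner-opposite-side : ∀ y → assign bit sign y j ≡ not (assign bit sign y i)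
      partner-opposite-side y = begin
        lookup y (bit j) xor sign j
          ≡⟨ cong₂ (λ b s → lookup y b xor s) (sym partners-share-bit) (¬-not (partners-opposite-sign ∘ sym)) ⟩
        lookup y (bit i) xor not (sign i)     ≡⟨ sym (not-distribʳ-xor (lookup y (bit i)) (sign i)) ⟩
        not (lookup y (bit i) xor sign i)     ∎
        where open ≡-Reasoning

      partners-never-uncut : ∀ (e : Subset n) → lookup e i ≡ true → lookup e j ≡ true → ∀ y → uncut (cut y) e ≡ 0
      partners-never-uncut e i∈e j∈e y with assign bit sign y i in side-i
      ... | true  = cong (𝟙 ∘ not) (crosses-≡true (cut y) e i j i∈e j∈e (trans (lookup∘tabulate _ i) side-i)
                      (trans (lookup∘tabulate _ j) (trans (partner-opposite-side y) (cong not side-i))))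
      ... | false = cong (𝟙 ∘ not) (crosses-≡true (cut y) e j i j∈e i∈e
                      (trans (lookup∘tabulate _ j) (trans (partner-opposite-side y) (cong not side-i)))
                      (trans (lookup∘tabulate _ i) side-i))

    sumCube-uncut-≤ : ∀ {k} (e : Subset n) → ∣ e ∣ ≡ suc k →
                  2 ^ k * sumCube (n + n) (λ y → uncut (cut y) e) ≤ 2 ^ (n + n)
    sumCube-uncut-≤ {k} e ∣e∣≡1+k = *-cancelˡ-≤ 2 (begin
      2 * (2 ^ k * sumCube N (λ y → uncut (cut y) e))          ≡⟨ *-assoc 2 (2 ^ k) _ ⟨
      2 ^ suc k * sumCube N (λ y → uncut (cut y) e)
        ≤⟨ *-monoʳ-≤ (2 ^ suc k) (sumCube-mono-≤ N (λ y → uncut-≤-allOn e (assign bit sign y))) ⟩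
      2 ^ suc k * sumCube N (λ y → 𝟙 (all y) + 𝟙 (none y))     ≡⟨ cong (2 ^ suc k *_) (sumCube-+ N (𝟙 ∘ all) (𝟙 ∘ none)) ⟩
      2 ^ suc k * (sumCube N (𝟙 ∘ all) + sumCube N (𝟙 ∘ none)) ≡⟨ *-distribˡ-+ (2 ^ suc k) _ _ ⟩
      2 ^ suc k * sumCube N (𝟙 ∘ all) + 2 ^ suc k * sumCube N (𝟙 ∘ none)
        ≤⟨ +-mono-≤ (count sign (λ i j i≢j _ _ → shared-bit⇒opposite-sign i j i≢j))
                    (≤-trans (≤-reflexive (cong (2 ^ suc k *_) (sumCube-cong N (cong 𝟙 ∘ none≡all-flipped))))
                             (count (not ∘ sign) (λ i j i≢j _ _ eq → shared-bit⇒opposite-sign i j i≢j eq ∘ Bool.not-injective))) ⟩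
      2 ^ N + 2 ^ N                                            ≡⟨ cong (2 ^ N +_) (+-identityʳ _) ⟨
      2 * 2 ^ N                                                ∎)
      where
      open ≤-Reasoning
      N = n + n
      all none : Vec Bool N → Bool
      all  y = allOn e (assign bit sign y)
      none y = allOn e (not ∘ assign bit sign y)
      none≡all-flipped : ∀ y → none y ≡ allOn e (assign bit (not ∘ sign) y)
      none≡all-flipped y = allOn-cong e (λ i _ → not-distribʳ-xor (lookup y (bit i)) (sign i))
      count : ∀ sign′ → SignSeparated bit sign′ e → 2 ^ suc k * sumCube N (λ y → 𝟙 (allOn e (assign bit sign′ y))) ≤ 2 ^ N
      count sign′ sep =
        subst (λ m → 2 ^ m * sumCube N (λ y → 𝟙 (allOn e (assign bit sign′ y))) ≤ 2 ^ N) ∣e∣≡1+k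
              (sumCube-allOn-≤ e bit sign′ sep)

  heavy : ∀ {n} → Subset n → Subset n → ℕ
  heavy B e = 𝟙 (2 ≤ᵇ ∣ e ∩ B ∣)

  uncutSize : ∀ {k n} → Hypergraph k n → Subset n → ℕ
  uncutSize H S = sum (map (uncut S) (edges H))

  heavyEdges : ∀ {k n} → Subset n → Hypergraph k n → ℕ
  heavyEdges B H = sum (map (heavy B) (edges H))

  module PairingCuts {n} (B : Subset n) where
    open Pairing B

    L N : ℕ
    L = ∣ B ∣ + ∣ B ∣
    N = n + n

    uncutTotal : Subset n → ℕ
    uncutTotal e = sumBelow L (λ c → sumCube N (λ y → uncut (cut c y) e))

    uncutTotal-≤ : ∀ {k} (e : Subset n) → ∣ e ∣ ≡ suc k → 2 ^ k * uncutTotal e + heavy B e * 2 ^ N ≤ L * 2 ^ N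
    uncutTotal-≤ {k} e ∣e∣≡1+k rewrite sumBelow-*ˡ L (2 ^ k) (λ c → sumCube N (λ y → uncut (cut c y) e))
      with 2 ≤ᵇ ∣ e ∩ B ∣ in is-heavy
    ... | false = ≤-trans (≤-reflexive (+-identityʳ _)) (sumBelow-≤ L (λ c _ → sumCube-uncut-≤ c e ∣e∣≡1+k))
    ... | true with two-members (e ∩ B) (≤ᵇ⇒≤ 2 _ (subst T (sym is-heavy) _))
    ... | i , j , i≢j , i∈e∩B , j∈e∩B = begin
      S + 1 * 2 ^ N  ≡⟨ trans (cong (S +_) (*-identityˡ (2 ^ N))) (+-comm S (2 ^ N)) ⟩
      2 ^ N + S      ≤⟨ sumBelow-≤-vanishing L c₀ c₀<L (λ c _ → sumCube-uncut-≤ c e ∣e∣≡1+k) vanishes ⟩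
      L * 2 ^ N      ∎
      where
      open ≤-Reasoning
      S = sumBelow L (λ c → 2 ^ k * sumCube N (λ y → uncut (cut c y) e))
      i∈e = proj₁ (∈∩⁻ e B i i∈e∩B)
      i∈B = proj₂ (∈∩⁻ e B i i∈e∩B)
      j∈e = proj₁ (∈∩⁻ e B j j∈e∩B)
      j∈B = proj₂ (∈∩⁻ e B j j∈e∩B)
      c₀ = rank B i + rank B j
      c₀<L : c₀ < L
      c₀<L = +-mono-< (rank-< B i i∈B) (rank-< B j j∈B)
      vanishes : 2 ^ k * sumCube N (λ y → uncut (cut c₀ y) e) ≡ 0
      vanishes = trans (cong (2 ^ k *_) (trans (sumCube-cong N (partners-never-uncut c₀ i∈B j∈B i≢j refl e i∈e j∈e))
                                               (sumCube-zero N)))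
                       (*-zeroʳ (2 ^ k))

    sum-uncutSize-≤ : ∀ {k} (H : Hypergraph (suc k) n) →
                   2 ^ k * sumBelow L (λ c → sumCube N (λ y → uncutSize H (cut c y))) + heavyEdges B H * 2 ^ N
                     ≤ numEdges H * (L * 2 ^ N)
    sum-uncutSize-≤ {k} H = begin
      2 ^ k * sumBelow L (λ c → sumCube N (λ y → uncutSize H (cut c y))) + heavyEdges B H * 2 ^ N
        ≡⟨ cong (λ t → 2 ^ k * t + heavyEdges B H * 2 ^ N) per-edge ⟩
      2 ^ k * sum (map uncutTotal es) + heavyEdges B H * 2 ^ N
        ≡⟨ cong₂ _+_ (sum-map-*ˡ (2 ^ k) uncutTotal es) (sum-map-*ʳ (2 ^ N) (heavy B) es) ⟩
      sum (map (λ e → 2 ^ k * uncutTotal e) es) + sum (map (λ e → heavy B e * 2 ^ N) es)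
        ≡⟨ sum-map-+ (λ e → 2 ^ k * uncutTotal e) (λ e → heavy B e * 2 ^ N) es ⟨
      sum (map (λ e → 2 ^ k * uncutTotal e + heavy B e * 2 ^ N) es)
        ≤⟨ sum-map-mono-≤ es (uniform H) uncutTotal-≤ ⟩
      sum (map (λ _ → L * 2 ^ N) es)
        ≡⟨ sum-map-const (L * 2 ^ N) es ⟩
      numEdges H * (L * 2 ^ N) ∎
      where
      open ≤-Reasoning
      es = edges H
      per-edge : sumBelow L (λ c → sumCube N (λ y → uncutSize H (cut c y))) ≡ sum (map uncutTotal es)
      per-edge = trans
        (sumBelow-cong L (λ c → sum-map-swap (sumCube N) (sumCube-zero N) (sumCube-+ N) (λ y → uncut (cut c y)) es))
        (sum-map-swap (sumBelow L) (sumBelow-zero L) (sumBelow-+ L) (λ c e → sumCube N (λ y → uncut (cut c y) e)) es)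

    pairing-cut-exists : ∀ {k} (H : Hypergraph (suc k) n) → 0 < ∣ B ∣ →
                         ∃ λ S → 2 ^ k * L * uncutSize H S + heavyEdges B H ≤ L * numEdges H
    pairing-cut-exists {k} H ∣B∣>0 = cut c y , *-cancelʳ-≤ _ _ (2 ^ N) {{m^n≢0 2 N}} (begin
      (2 ^ k * L * u + p) * 2 ^ N       ≡⟨ rearrange₁ (2 ^ k) L u p (2 ^ N) ⟩
      2 ^ k * (L * (2 ^ N * u)) + p * 2 ^ N ≤⟨ +-monoˡ-≤ (p * 2 ^ N) (*-monoʳ-≤ (2 ^ k) (≤-trans (*-monoʳ-≤ L y-below) c-below)) ⟩
      2 ^ k * total + p * 2 ^ N          ≤⟨ sum-uncutSize-≤ H ⟩
      numEdges H * (L * 2 ^ N)          ≡⟨ rearrange₂ (numEdges H) L (2 ^ N) ⟩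
      L * numEdges H * 2 ^ N            ∎)
      where
      open ≤-Reasoning
      h : ℕ → ℕ
      h c = sumCube N (λ y → uncutSize H (cut c y))
      total = sumBelow L h
      c-avg = sumBelow-average L h (+-mono-< ∣B∣>0 ∣B∣>0)
      c = proj₁ c-avg
      c-below = proj₂ (proj₂ c-avg)
      y-avg = sumCube-average N (λ y → uncutSize H (cut c y))
      y = proj₁ y-avg
      y-below = proj₂ y-avg
      u = uncutSize H (cut c y)
      p = heavyEdges B H
      rearrange₁ : ∀ K L u p T → (K * L * u + p) * T ≡ K * (L * (T * u)) + p * T
      rearrange₁ = solve-∀
      rearrange₂ : ∀ m L T → m * (L * T) ≡ L * m * T
      rearrange₂ = solve-∀

  cutSize+uncutSize : ∀ {k n} (H : Hypergraph k n) S → cutSize H S + uncutSize H S ≡ numEdges H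
  cutSize+uncutSize H S = go (edges H)
    where
    go : ∀ es → length (filter (λ e → crosses S e Bool.≟ true) es) + sum (map (uncut S) es) ≡ length es
    go []       = refl
    go (e ∷ es) with crosses S e
    ... | true  = cong suc (go es)
    ... | false = trans (+-suc _ _) (cong suc (go es))

  inducedEdges≡sum : ∀ {k n} (H : Hypergraph k n) U → inducedEdges H U ≡ sum (map (λ e → 𝟙 (does (e ⊆? U))) (edges H))
  inducedEdges≡sum H U = go (edges H)
    where
    go : ∀ es → length (filter (_⊆? U) es) ≡ sum (map (λ e → 𝟙 (does (e ⊆? U))) es)
    go []       = refl
    go (e ∷ es) with e ⊆? U
    ... | yes _ = cong suc (go es)
    ... | no  _ = go es

  ∣p∩∁q∣+∣p∩q∣≡∣p∣ : ∀ {n} (p q : Subset n) → ∣ p ∩ ∁ q ∣ + ∣ p ∩ q ∣ ≡ ∣ p ∣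
  ∣p∩∁q∣+∣p∩q∣≡∣p∣ []          []          = refl
  ∣p∩∁q∣+∣p∩q∣≡∣p∣ (false ∷ p) (_     ∷ q) = ∣p∩∁q∣+∣p∩q∣≡∣p∣ p q
  ∣p∩∁q∣+∣p∩q∣≡∣p∣ (true  ∷ p) (true  ∷ q) = trans (+-suc _ _) (cong suc (∣p∩∁q∣+∣p∩q∣≡∣p∣ p q))
  ∣p∩∁q∣+∣p∩q∣≡∣p∣ (true  ∷ p) (false ∷ q) = cong suc (∣p∩∁q∣+∣p∩q∣≡∣p∣ p q)

  ∣p∩∁q∣≡0⇒p⊆q : ∀ {n} (p q : Subset n) → ∣ p ∩ ∁ q ∣ ≡ 0 → p ⊆ q
  ∣p∩∁q∣≡0⇒p⊆q (true  ∷ p) (true ∷ q) h here      = here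
  ∣p∩∁q∣≡0⇒p⊆q (true  ∷ p) (true ∷ q) h (there x) = there (∣p∩∁q∣≡0⇒p⊆q p q h x)
  ∣p∩∁q∣≡0⇒p⊆q (false ∷ p) (true ∷ q) h (there x) = there (∣p∩∁q∣≡0⇒p⊆q p q h x)
  ∣p∩∁q∣≡0⇒p⊆q (false ∷ p) (false ∷ q) h (there x) = there (∣p∩∁q∣≡0⇒p⊆q p q h x)

  𝟙-⊆? : ∀ {n} {e U : Subset n} → e ⊆ U → 𝟙 (does (e ⊆? U)) ≡ 1
  𝟙-⊆? {e = e} {U} e⊆U with e ⊆? U
  ... | yes _   = refl
  ... | no  e⊈U = ⊥-elim (e⊈U e⊆U)

  heavy-≡1 : ∀ {n} (B e : Subset n) → 2 ≤ ∣ e ∩ B ∣ → heavy B e ≡ 1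
  heavy-≡1 B e 2≤∣e∩B∣ with 2 ≤ᵇ ∣ e ∩ B ∣ in is-heavy
  ... | true  = refl
  ... | false = ⊥-elim (subst T is-heavy (≤⇒≤ᵇ 2≤∣e∩B∣))

  uncut-∁-≤ : ∀ {n} (U e : Subset n) → 2 ≤ ∣ e ∣ → uncut (∁ U) e ≤ 𝟙 (does (e ⊆? U)) + heavy (∁ U) e
  uncut-∁-≤ U e 2≤∣e∣ = by-size ∣ e ∩ ∁ U ∣ refl
    where
    induced = 𝟙 (does (e ⊆? U))
    by-size : ∀ x → ∣ e ∩ ∁ U ∣ ≡ x → uncut (∁ U) e ≤ induced + heavy (∁ U) e
    by-size zero inB = begin
      uncut (∁ U) e            ≤⟨ 𝟙≤1 _ ⟩
      1                        ≡⟨ 𝟙-⊆? (∣p∩∁q∣≡0⇒p⊆q e U inB) ⟨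
      induced                  ≤⟨ m≤m+n induced _ ⟩
      induced + heavy (∁ U) e  ∎
      where open ≤-Reasoning
    by-size (suc (suc x)) inB = begin
      uncut (∁ U) e            ≤⟨ 𝟙≤1 _ ⟩
      1                        ≡⟨ heavy-≡1 (∁ U) e (subst (2 ≤_) (sym inB) (s≤s (s≤s z≤n))) ⟨
      heavy (∁ U) e            ≤⟨ m≤n+m _ induced ⟩
      induced + heavy (∁ U) e  ∎
      where open ≤-Reasoning
    by-size (suc zero) inB =
      ≤-trans (≤-reflexive (cong (𝟙 ∘ not) (crosses-intro (∁ U) e (subst (0 <_) (sym inB) (s≤s z≤n)) inU))) z≤n
      where
      sizes : ∣ e ∩ ∁ (∁ U) ∣ + 1 ≡ ∣ e ∣
      sizes = trans (cong (∣ e ∩ ∁ (∁ U) ∣ +_) (sym inB)) (∣p∩∁q∣+∣p∩q∣≡∣p∣ e (∁ U))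
      inU : 0 < ∣ e ∩ ∁ (∁ U) ∣
      inU = ≤-pred (subst (2 ≤_) (trans (sym sizes) (+-comm _ 1)) 2≤∣e∣)

  uncutSize-∁-≤ : ∀ {k n} (H : Hypergraph (suc (suc k)) n) U →
                  uncutSize H (∁ U) ≤ inducedEdges H U + heavyEdges (∁ U) H
  uncutSize-∁-≤ {k} H U = begin
    uncutSize H (∁ U)                                              ≤⟨ sum-map-mono-≤ (edges H) (uniform H) bound ⟩
    sum (map (λ e → 𝟙 (does (e ⊆? U)) + heavy (∁ U) e) (edges H)) ≡⟨ sum-map-+ _ (heavy (∁ U)) (edges H) ⟩
    _ + heavyEdges (∁ U) H                                         ≡⟨ cong (_+ heavyEdges (∁ U) H) (inducedEdges≡sum H U) ⟨
    inducedEdges H U + heavyEdges (∁ U) H                          ∎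
    where
    open ≤-Reasoning
    bound : ∀ e → ∣ e ∣ ≡ suc (suc k) → uncut (∁ U) e ≤ 𝟙 (does (e ⊆? U)) + heavy (∁ U) e
    bound e ∣e∣≡k = uncut-∁-≤ U e (subst (2 ≤_) (sym ∣e∣≡k) (s≤s (s≤s z≤n)))

  all-edges-induced : ∀ {k n} (H : Hypergraph k n) U → ∣ ∁ U ∣ ≡ 0 → inducedEdges H U ≡ numEdges H
  all-edges-induced H U ∣∁U∣≡0 = cong length (filter-all (_⊆? U) (universal inside (edges H)))
    where
    inside : ∀ e → e ⊆ U
    inside e = ∣p∩∁q∣≡0⇒p⊆q e U (n≤0⇒n≡0 (subst (∣ e ∩ ∁ U ∣ ≤_) ∣∁U∣≡0 (∣p∩q∣≤∣q∣ e (∁ U))))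

  -- The target m + 8K²b·u ≤ 8Kb·m is b · excess ≥ m/(8K²) multiplied out.

  excess-target-from-B : ∀ K b {m a p u} .{{_ : NonZero K}} .{{_ : NonZero b}} → u ≤ a + p → a * (8 * K * K) ≤ m → 4 * K * p ≤ m →
                         m + 8 * K * K * b * u ≤ 8 * K * b * m
  excess-target-from-B K b {m} {a} {p} {u} u≤a+p aQ≤m 4Kp≤m = begin
    m + 8 * K * K * b * u                          ≤⟨ +-monoʳ-≤ m (*-monoʳ-≤ (8 * K * K * b) u≤a+p) ⟩
    m + 8 * K * K * b * (a + p)                    ≡⟨ cong (m +_) (split-a-p K b a p) ⟩
    m + (b * (a * (8 * K * K)) + 2 * K * b * (4 * K * p))
      ≤⟨ +-monoʳ-≤ m (+-mono-≤ (*-monoʳ-≤ b aQ≤m) (*-monoʳ-≤ (2 * K * b) 4Kp≤m)) ⟩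
    m + (b * m + 2 * K * b * m)                    ≤⟨ +-mono-≤ (≤-trans (m≤n*m m b) (m≤n*m _ K)) (+-monoˡ-≤ _ (m≤n*m _ K)) ⟩
    K * (b * m) + (K * (b * m) + 2 * K * b * m)    ≤⟨ m≤m+n _ (4 * K * b * m) ⟩
    K * (b * m) + (K * (b * m) + 2 * K * b * m) + 4 * K * b * m ≡⟨ collect K b m ⟩
    8 * K * b * m                                  ∎
    where
    open ≤-Reasoning
    split-a-p : ∀ K b a p → 8 * K * K * b * (a + p) ≡ b * (a * (8 * K * K)) + 2 * K * b * (4 * K * p)
    split-a-p = solve-∀
    collect : ∀ K b m → K * (b * m) + (K * (b * m) + 2 * K * b * m) + 4 * K * b * m ≡ 8 * K * b * m
    collect = solve-∀

  excess-target-from-pairing : ∀ K b {m p u} → K * (b + b) * u + p ≤ (b + b) * m → m ≤ 4 * K * p →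
                               m + 8 * K * K * b * u ≤ 8 * K * b * m
  excess-target-from-pairing K b {m} {p} {u} averaged m≤4Kp = begin
    m + 8 * K * K * b * u                ≤⟨ +-monoˡ-≤ _ m≤4Kp ⟩
    4 * K * p + 8 * K * K * b * u        ≡⟨ factor K b p u ⟩
    4 * K * (K * (b + b) * u + p)        ≤⟨ *-monoʳ-≤ (4 * K) averaged ⟩
    4 * K * ((b + b) * m)                ≡⟨ expand K b m ⟩
    8 * K * b * m                        ∎
    where
    open ≤-Reasoning
    factor : ∀ K b p u → 4 * K * p + 8 * K * K * b * u ≡ 4 * K * (K * (b + b) * u + p)
    factor = solve-∀
    expand : ∀ K b m → 4 * K * ((b + b) * m) ≡ 8 * K * b * m
    expand = solve-∀

  module _ {j n} (H : Hypergraph (suc (suc j)) n) (U : Subset n) (b : ℕ) (∣U∣+b≡n : ∣ U ∣ + b ≡ n) where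

    private
      K m a : ℕ
      K = 2 ^ suc j
      m = numEdges H
      a = inducedEdges H U
      instance
        K≢0 : NonZero K
        K≢0 = m^n≢0 2 (suc j)
        8KK≢0 : NonZero (8 * K * K)
        8KK≢0 = m*n≢0 (8 * K) K {{m*n≢0 8 K}}

    ∣∁U∣≡b : ∣ ∁ U ∣ ≡ b
    ∣∁U∣≡b = trans (∣∁p∣≡n∸∣p∣ U) (trans (cong (_∸ ∣ U ∣) (sym ∣U∣+b≡n)) (m+n∸m≡n ∣ U ∣ b))

    induced-or-good-cut : m ≤ a * (8 * K * K) ⊎ (0 < b × ∃ λ S → m + 8 * K * K * b * uncutSize H S ≤ 8 * K * b * m)
    induced-or-good-cut with m ≤? a * (8 * K * K)
    ... | yes m≤aQ = inj₁ m≤aQ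
    ... | no  m≰aQ = inj₂ (b>0 , good-cut (4 * K * p ≤? m))
      where
      aQ≤m = <⇒≤ (≰⇒> m≰aQ)
      p = heavyEdges (∁ U) H
      b>0 : 0 < b
      b>0 = n≢0⇒n>0 λ b≡0 → m≰aQ (subst (λ x → m ≤ x * (8 * K * K))
                                        (sym (all-edges-induced H U (trans ∣∁U∣≡b b≡0))) (m≤m*n m (8 * K * K)))
      good-cut : Dec (4 * K * p ≤ m) → ∃ λ S → m + 8 * K * K * b * uncutSize H S ≤ 8 * K * b * m
      good-cut (yes 4Kp≤m) = ∁ U , excess-target-from-B K b {{K≢0}} {{>-nonZero b>0}} (uncutSize-∁-≤ H U) aQ≤m 4Kp≤m
      good-cut (no 4Kp≰m)  = S , excess-target-from-pairing K b averaged (<⇒≤ (≰⇒> 4Kp≰m))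
        where
        pairing = PairingCuts.pairing-cut-exists (∁ U) H (subst (0 <_) (sym ∣∁U∣≡b) b>0)
        S = proj₁ pairing
        averaged : K * (b + b) * uncutSize H S + p ≤ (b + b) * m
        averaged = subst (λ x → K * (x + x) * uncutSize H S + p ≤ (x + x) * m) ∣∁U∣≡b (proj₂ pairing)

module Rationals where

  open import Data.Nat using (ℕ; zero; suc; _^_) renaming (_+_ to _+ℕ_; _*_ to _*ℕ_; _≤_ to _≤ℕ_)
  import Data.Nat.Properties as ℕ
  open import Data.Integer using (+_)
  import Data.Integer.Properties as ℤ
  import Data.Integer.Solver
  open import Data.Rational
  open import Data.Rational.Properties
  open import Algebra.Bundles using (CommutativeMonoid)
  open import Algebra.Properties.CommutativeSemigroup (CommutativeMonoid.commutativeSemigroup *-1-commutativeMonoid)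
    using (interchange)
  import Data.Rational.Solver
  module ℚ-Solver = Data.Rational.Solver.+-*-Solver
  import Data.Rational.Unnormalised as ℚᵘ
  import Data.Rational.Unnormalised.Properties as ℚᵘ
  open import Relation.Binary.PropositionalEquality
  open import Defs using (halfPow)

  ι : ℕ → ℚ
  ι n = + n / 1

  ι≃ : ∀ n → toℚᵘ (ι n) ℚᵘ.≃ ℚᵘ.mkℚᵘ (+ n) 0
  ι≃ n = toℚᵘ-fromℚᵘ (ℚᵘ.mkℚᵘ (+ n) 0)

  ι-+ : ∀ a b → ι (a +ℕ b) ≡ ι a + ι b
  ι-+ a b = toℚᵘ-injective (begin-equality
    toℚᵘ (ι (a +ℕ b))                      ≃⟨ ι≃ (a +ℕ b) ⟩
    ℚᵘ.mkℚᵘ (+ (a +ℕ b)) 0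
      ≃⟨ ℚᵘ.*≡* (ℤ-Solver.solve 2 (λ x y → (x :+ y) :* con (+ 1) := (x :* con (+ 1) :+ y :* con (+ 1)) :* con (+ 1))
                                refl (+ a) (+ b)) ⟩
    ℚᵘ.mkℚᵘ (+ a) 0 ℚᵘ.+ ℚᵘ.mkℚᵘ (+ b) 0   ≃⟨ ℚᵘ.+-cong (ℚᵘ.≃-sym (ι≃ a)) (ℚᵘ.≃-sym (ι≃ b)) ⟩
    toℚᵘ (ι a) ℚᵘ.+ toℚᵘ (ι b)             ≃⟨ toℚᵘ-homo-+ (ι a) (ι b) ⟨
    toℚᵘ (ι a + ι b)                       ∎)
    where
    open ℚᵘ.≤-Reasoning
    module ℤ-Solver = Data.Integer.Solver.+-*-Solver
    open ℤ-Solver using (_:+_; _:*_; _:=_; con)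

  ι-* : ∀ a b → ι (a *ℕ b) ≡ ι a * ι b
  ι-* a b = toℚᵘ-injective (begin-equality
    toℚᵘ (ι (a *ℕ b))                      ≃⟨ ι≃ (a *ℕ b) ⟩
    ℚᵘ.mkℚᵘ (+ (a *ℕ b)) 0                 ≃⟨ ℚᵘ.*≡* (cong (Data.Integer._* + 1) (ℤ.pos-* a b)) ⟩
    ℚᵘ.mkℚᵘ (+ a) 0 ℚᵘ.* ℚᵘ.mkℚᵘ (+ b) 0   ≃⟨ ℚᵘ.*-cong (ℚᵘ.≃-sym (ι≃ a)) (ℚᵘ.≃-sym (ι≃ b)) ⟩
    toℚᵘ (ι a) ℚᵘ.* toℚᵘ (ι b)             ≃⟨ toℚᵘ-homo-* (ι a) (ι b) ⟨
    toℚᵘ (ι a * ι b)                       ∎)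
    where open ℚᵘ.≤-Reasoning

  ι-mono-≤ : ∀ {a b} → a ≤ℕ b → ι a ≤ ι b
  ι-mono-≤ {a} {b} a≤b = toℚᵘ-cancel-≤ (begin
    toℚᵘ (ι a)      ≃⟨ ι≃ a ⟩
    ℚᵘ.mkℚᵘ (+ a) 0 ≤⟨ ℚᵘ.*≤* (ℤ.*-monoʳ-≤-nonNeg (+ 1) (Data.Integer.+≤+ a≤b)) ⟩
    ℚᵘ.mkℚᵘ (+ b) 0 ≃⟨ ι≃ b ⟨
    toℚᵘ (ι b)      ∎)
    where open ℚᵘ.≤-Reasoning

  ι-*₃ : ∀ a b c → ι (a *ℕ b *ℕ c) ≡ ι a * ι b * ι c
  ι-*₃ a b c = trans (ι-* (a *ℕ b) c) (cong (_* ι c) (ι-* a b))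

  ι-*₄ : ∀ a b c d → ι (a *ℕ b *ℕ c *ℕ d) ≡ ι a * ι b * ι c * ι d
  ι-*₄ a b c d = trans (ι-* (a *ℕ b *ℕ c) d) (cong (_* ι d) (ι-*₃ a b c))

  ι-*₅ : ∀ a b c d e → ι (a *ℕ b *ℕ c *ℕ d *ℕ e) ≡ ι a * ι b * ι c * ι d * ι e
  ι-*₅ a b c d e = trans (ι-* (a *ℕ b *ℕ c *ℕ d) e) (cong (_* ι e) (ι-*₄ a b c d))

  halfPow-inverse : ∀ j → halfPow j * ι (2 ^ j) ≡ 1ℚ
  halfPow-inverse zero    = refl
  halfPow-inverse (suc j) = begin
    ½ * halfPow j * ι (2 *ℕ 2 ^ j)       ≡⟨ cong (½ * halfPow j *_) (ι-* 2 (2 ^ j)) ⟩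
    ½ * halfPow j * (ι 2 * ι (2 ^ j))    ≡⟨ interchange ½ (halfPow j) (ι 2) (ι (2 ^ j)) ⟩
    ½ * ι 2 * (halfPow j * ι (2 ^ j))    ≡⟨ cong (½ * ι 2 *_) (halfPow-inverse j) ⟩
    1ℚ                                   ∎
    where open ≡-Reasoning

  halfPow-positive : ∀ j → Positive (halfPow j)
  halfPow-positive zero    = _
  halfPow-positive (suc j) = pos*pos⇒pos ½ (halfPow j) {{halfPow-positive j}}

  constant : ℕ → ℚ
  constant j = halfPow 3 * (halfPow j * halfPow j)

  constant-positive : ∀ j → 0ℚ < constant j
  constant-positive j = positive⁻¹ (constant j)
    {{pos*pos⇒pos (halfPow 3) (halfPow j * halfPow j)
      {{pos*pos⇒pos (halfPow j) {{halfPow-positive j}} (halfPow j) {{halfPow-positive j}}}}}}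

  module _ (j : ℕ) where

    private
      K Q : ℕ
      K = 2 ^ j
      Q = 8 *ℕ K *ℕ K
      h k : ℚ
      h = halfPow j
      k = ι K

    constant-inverse : constant j * ι Q ≡ 1ℚ
    constant-inverse = begin
      halfPow 3 * (h * h) * ι Q          ≡⟨ cong (halfPow 3 * (h * h) *_) (ι-*₃ 8 K K) ⟩
      halfPow 3 * (h * h) * (ι 8 * k * k)
        ≡⟨ ℚ-Solver.solve 4 (λ a h e k → a :* (h :* h) :* (e :* k :* k) := a :* e :* ((h :* k) :* (h :* k)))
                            refl (halfPow 3) h (ι 8) k ⟩
      halfPow 3 * ι 8 * ((h * k) * (h * k)) ≡⟨ cong (λ x → halfPow 3 * ι 8 * (x * x)) (halfPow-inverse j) ⟩
      1ℚ                                   ∎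
      where
      open ≡-Reasoning
      open ℚ-Solver using (_:*_; _:=_)

    Q-positive : Positive (ι Q)
    Q-positive = normalize-pos Q 1 {{_}} {{ℕ.m*n≢0 (8 *ℕ K) K {{ℕ.m*n≢0 8 K {{_}} {{ℕ.m^n≢0 2 j}}}} {{ℕ.m^n≢0 2 j}}}}

    constant-scaled : ∀ x → constant j * x * ι Q ≡ x
    constant-scaled x = begin
      constant j * x * ι Q   ≡⟨ cong (_* ι Q) (*-comm (constant j) x) ⟩
      x * constant j * ι Q   ≡⟨ *-assoc x (constant j) (ι Q) ⟩
      x * (constant j * ι Q) ≡⟨ cong (x *_) constant-inverse ⟩
      x * 1ℚ                 ≡⟨ *-identityʳ x ⟩
      x                      ∎
      where open ≡-Reasoning

    constant-≤-induced : ∀ m a → m ≤ℕ a *ℕ Q → constant j * ι m ≤ ι a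
    constant-≤-induced m a m≤aQ = *-cancelʳ-≤-pos (ι Q) {{Q-positive}} (begin
      constant j * ι m * ι Q ≡⟨ constant-scaled (ι m) ⟩
      ι m                    ≤⟨ ι-mono-≤ m≤aQ ⟩
      ι (a *ℕ Q)             ≡⟨ ι-* a Q ⟩
      ι a * ι Q              ∎)
      where open ≤-Reasoning

    -- Multiplied by ι Q = 8K², the excess becomes 8Kb·m − 8K²b·u, because h·K = 1.
    constant-≤-excess : ∀ {m b cut u} → cut +ℕ u ≡ m → m +ℕ Q *ℕ b *ℕ u ≤ℕ 8 *ℕ K *ℕ b *ℕ m →
                        constant j * ι m ≤ ι b * (ι cut - (1ℚ - h) * ι m)
    constant-≤-excess {m} {b} {cut} {u} cut+u≡m target = *-cancelʳ-≤-pos (ι Q) {{Q-positive}} (begin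
      constant j * ι m * ι Q                 ≡⟨ constant-scaled (ι m) ⟩
      ι m                                    ≡⟨ ℚ-Solver.solve 2 (λ x y → x := x :+ y :- y) refl (ι m) (ι Y) ⟩
      ι m + ι Y - ι Y                        ≡⟨ cong (_- ι Y) (ι-+ m Y) ⟨
      ι (m +ℕ Y) - ι Y                       ≤⟨ +-monoˡ-≤ (- ι Y) (ι-mono-≤ target) ⟩
      ι X - ι Y                              ≡⟨ cong₂ _-_ (ι-*₄ 8 K b m) (ι-*₅ 8 K K b u) ⟩
      E * k * B * M - E * k * k * B * U      ≡⟨ cong (λ x → E * k * B * x - E * k * k * B * U) M≡C+U ⟩
      E * k * B * (C + U) - E * k * k * B * U ≡⟨ cong (_- E * k * k * B * U) (*-identityʳ (E * k * B * (C + U))) ⟨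
      E * k * B * (C + U) * 1ℚ - E * k * k * B * U
        ≡⟨ cong (λ x → E * k * B * (C + U) * x - E * k * k * B * U) (halfPow-inverse j) ⟨
      E * k * B * (C + U) * (h * k) - E * k * k * B * U
        ≡⟨ ℚ-Solver.solve 6 (λ E k h B C U →
             E :* k :* B :* (C :+ U) :* (h :* k) :- E :* k :* k :* B :* U
               := B :* (C :- (con 1ℚ :- h) :* (C :+ U)) :* (E :* k :* k)) refl E k h B C U ⟩
      B * (C - (1ℚ - h) * (C + U)) * (E * k * k) ≡⟨ cong₂ (λ x y → B * (C - (1ℚ - h) * x) * y) (sym M≡C+U) (sym (ι-*₃ 8 K K)) ⟩
      B * (C - (1ℚ - h) * M) * ι Q           ∎)
      where
      open ≤-Reasoning
      open ℚ-Solver using (_:+_; _:-_; _:*_; _:=_; con)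
      X Y : ℕ
      X = 8 *ℕ K *ℕ b *ℕ m
      Y = Q *ℕ b *ℕ u
      E B C U M : ℚ
      E = ι 8
      B = ι b
      C = ι cut
      U = ι u
      M = ι m
      M≡C+U : M ≡ C + U
      M≡C+U = trans (cong ι (sym cut+u≡m)) (ι-+ cut u)

open import Defs
open import Data.Nat using (ℕ; _+_; _≤_; suc; s≤s; z≤n)
open import Data.Integer using (+_)
open import Data.Rational using (ℚ; _/_; _*_; _<_; 0ℚ)
import Data.Rational as ℚ
open import Data.Fin.Subset using (Subset; ∣_∣)
open import Data.Product using (Σ; ∃; _×_; _,_)
open import Data.Sum using (_⊎_)
import Data.Sum
open import Relation.Binary.PropositionalEquality using (_≡_)

open Combinatorics using (cutSize+uncutSize; induced-or-good-cut)
open Rationals using (constant; constant-positive; constant-≤-induced; constant-≤-excess)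

lemma5p3 : (k : ℕ) → 2 ≤ k →
    Σ ℚ λ c → 0ℚ < c ×
      ((n : ℕ) (H : Hypergraph k n) (U : Subset n) (b : ℕ) → ∣ U ∣ + b ≡ n →
        (c * (+ numEdges H / 1) ℚ.≤ (+ inducedEdges H U / 1))
        ⊎ ((0 Data.Nat.< b) ×
           ∃ λ (S : Subset n) → c * (+ numEdges H / 1) ℚ.≤ (+ b / 1) * excess H S))
lemma5p3 (suc (suc j)) (s≤s (s≤s z≤n)) = constant (suc j) , constant-positive (suc j) , λ n H U b ∣U∣+b≡n →
  Data.Sum.map (constant-≤-induced (suc j) (numEdges H) (inducedEdges H U))
               (λ (b>0 , S , target) → b>0 , S , constant-≤-excess (suc j) (cutSize+uncutSize H S) target)
               (induced-or-good-cut H U b ∣U∣+b≡n)
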